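{- Let $\tau$ be a finite unary (monadic) vocabulary, let $c_\tau := 15|\tau|2^{|\tau|}$, and let $\mathfrak{M}$ be a $\tau$-model of size $n$. Let $T = \{\pi_1, \dots, \pi_\ell\}$ be the $\tau$-types realized in $\mathfrak{M}$, enumerated so that $|\pi_1| \leq |\pi_2| \leq \dots \leq |\pi_\ell|$, where $|\pi|$ denotes the number of points of $\mathfrak{M}$ realizing $\pi$. Then \[ C(\mathfrak{M}) \leq \min\big(3|\pi_\ell| + c_\tau,\ 6|\pi_{\ell-1}| + c_\tau\big). \]
   Context: A $\tau$-model of size $n$ is a structure $\mathfrak{M} = (M, P_1^{\mathfrak{M}}, \dots, P_k^{\mathfrak{M}})$ with domain $M = \{1,\dots,n\}$ and $P_i^{\mathfrak{M}} \subseteq M$, where $\tau = \{P_1,\dots,P_k\}$ consists of unary relation symbols. A $\tau$-type is a subset $\pi \subseteq \tau$; a point $a$ realizes $\pi$ if for all $P\in\tau$, $a \in P^{\mathfrak{M}}$ iff $P \in \pi$. First-order formulas $\mathrm{FO}[\tau]$ are built from atomic formulas $x=y$, $P(x)$ using $\neg,\lor,\land,\exists,\forall$, and are taken in negation normal form (negations only on atoms). The size of a formula is the number of atomic formulas (including negated atoms), conjunctions, disjunctions and quantifiers in it; negations do not count. A sentence $\varphi$ defines $\mathfrak{M}$ if for every $\tau$-model $\mathfrak{M}'$ of size $n$, $\mathfrak{M}' \models \varphi$ iff $\mathfrak{M}'$ is isomorphic to $\mathfrak{M}$. The description complexity $C(\mathfrak{M})$ is the minimum size of an $\mathrm{FO}[\tau]$-formula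 defining $\mathfrak{M}$. -}

module Defs where

open import Data.Nat using (ℕ; zero; suc; _+_; _*_; _^_; _⊓_)
open import Data.Bool using (Bool; true; false)
open import Data.Fin using (Fin; fromℕ; inject₁) renaming (zero to fzero; suc to fsuc)
open import Data.Fin.Subset using (Subset; ∣_∣)
open import Data.Vec using (Vec; []; _∷_; lookup; tabulate)
open import Data.Vec.Properties using (≡-dec)
import Data.Bool.Properties as BoolP
open import Data.Product using (Σ; _×_)
open import Data.Unit using (⊤)
open import Data.Empty using (⊥)
open import Data.Sum using (_⊎_)
open import Relation.Binary.PropositionalEquality using (_≡_; _≢_)
open import Relation.Nullary using (¬_; does)
open import Function.Bundles using (_⤖_; _⇔_; Bijection)

-- Vocabulary τ = {P_0, …, P_{k-1}} (k unary relation symbols, indexed by Fin k).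
-- A τ-model of size n: domain Fin n (standing for {1,…,n}); P_i interpreted as a subset.
record Model (k n : ℕ) : Set where
  constructor model
  field
    rel : Fin k → Subset n
open Model public

-- A τ-type is a subset of τ.
TypeT : ℕ → Set
TypeT k = Subset k

typeOf : ∀ {k n} → Model k n → Fin n → TypeT k
typeOf M a = tabulate (λ i → lookup (rel M i) a)

Realizes : ∀ {k n} → Model k n → Fin n → TypeT k → Set
Realizes M a π = typeOf M a ≡ π

count : ∀ {k n} → Model k n → TypeT k → ℕ
count {k} M π = ∣ tabulate (λ a → does (≡-dec BoolP._≟_ (typeOf M a) π)) ∣

_≅_ : ∀ {k n} → Model k n → Model k n → Set
_≅_ {k} {n} M N = Σ (Fin n ⤖ Fin n) λ f →
  ∀ (i : Fin k) (a : Fin n) → lookup (rel M i) a ≡ lookup (rel N i) (Bijection.to f a)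

-- FO[τ] formulas in negation normal form, with m free (de Bruijn) variables.
data Formula (k : ℕ) : ℕ → Set where
  eq     : ∀ {m} → Fin m → Fin m → Formula k m
  neq    : ∀ {m} → Fin m → Fin m → Formula k m
  pos    : ∀ {m} → Fin k → Fin m → Formula k m
  neg    : ∀ {m} → Fin k → Fin m → Formula k m
  _∧f_   : ∀ {m} → Formula k m → Formula k m → Formula k m
  _∨f_   : ∀ {m} → Formula k m → Formula k m → Formula k m
  exf    : ∀ {m} → Formula k (suc m) → Formula k m
  allf   : ∀ {m} → Formula k (suc m) → Formula k m

Sentence : ℕ → Set
Sentence k = Formula k 0

size : ∀ {k m} → Formula k m → ℕ
size (eq _ _)  = 1
size (neq _ _) = 1
size (pos _ _) = 1
size (neg _ _) = 1
size (φ ∧f ψ)  = suc (size φ + size ψ)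
size (φ ∨f ψ)  = suc (size φ + size ψ)
size (exf φ)   = suc (size φ)
size (allf φ)  = suc (size φ)

Sat : ∀ {k n m} → Model k n → Vec (Fin n) m → Formula k m → Set
Sat M ρ (eq x y)  = lookup ρ x ≡ lookup ρ y
Sat M ρ (neq x y) = lookup ρ x ≢ lookup ρ y
Sat M ρ (pos P x) = lookup (rel M P) (lookup ρ x) ≡ true
Sat M ρ (neg P x) = lookup (rel M P) (lookup ρ x) ≡ false
Sat M ρ (φ ∧f ψ)  = Sat M ρ φ × Sat M ρ ψ
Sat M ρ (φ ∨f ψ)  = Sat M ρ φ ⊎ Sat M ρ ψ
Sat {n = n} M ρ (exf φ)  = Σ (Fin n) λ a → Sat M (a ∷ ρ) φ
Sat {n = n} M ρ (allf φ) = (a : Fin n) → Sat M (a ∷ ρ) φ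

_⊨_ : ∀ {k n} → Model k n → Sentence k → Set
M ⊨ φ = Sat M [] φ

Defines : ∀ {k n} → Sentence k → Model k n → Set
Defines {k} {n} φ M = (M' : Model k n) → (M' ⊨ φ) ⇔ (M' ≅ M)

cτ : ℕ → ℕ
cτ k = 15 * k * 2 ^ k

-- The bound min(3|π_ℓ| + c, 6|π_{ℓ-1}| + c), for an enumeration s of the counts
-- indexed by Fin ℓ (s (fromℕ ..) = last, inject₁ (fromℕ ..) = second-to-last).
-- For ℓ = 1 the second term is undefined and only the first is used.
-- ℓ = 0 cannot occur for n ≥ 1 (value irrelevant).
bound : ℕ → (ℓ : ℕ) → (Fin ℓ → ℕ) → ℕ
bound c zero s = 0
bound c (suc zero) s = 3 * s (fromℕ zero) + c
bound c (suc (suc m)) s =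
  (3 * s (fromℕ (suc m)) + c) ⊓ (6 * s (inject₁ (fromℕ m)) + c)

{-# OPTIONS --safe #-}
-- A model over a monadic vocabulary is determined up to isomorphism by how many points realize
-- each type, so a defining sentence only has to fix these counts. "At most h points have the type
-- of z" costs about 3h symbols: h existential variables x₀ … x_{h-1} and the disjunction
-- y = x₀ ∨ … ∨ y = x_{h-1}. As the counts h₁ ≤ … ≤ h_ℓ are sorted, one block of variables serves
-- all types at once: the disjunction for π_s extends the one for π_{s-1} by
-- y = x_{h_{s-1}} ∨ … ∨ y = x_{h_s - 1}.
-- Upper bounds on all counts already fix the model, because the counts of a model of size n sum
-- to n; this gives 3|π_ℓ| + c_τ. Dually, "any h - 1 points miss some point of the type of z"
-- bounds counts from below; fixing the counts of all types but the most frequent one,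
-- whose count is then forced, gives 6|π_{ℓ-1}| + c_τ. The type formulas and the conjunctions over
-- types are absorbed by c_τ, as ℓ ≤ 2^|τ|.

module Submission where

open import Defs
open import Data.Nat using (ℕ; _≤_; _*_; _+_)
open import Data.Fin using (Fin) renaming (_≤_ to _≤F_)
open import Data.Product using (Σ; _×_; ∃)
open import Relation.Binary.PropositionalEquality using (_≡_)
open import Function.Definitions using (Injective)

open import Data.Nat.Properties
open import Data.Nat.Tactic.RingSolver using (solve-∀)
open import Algebra.Properties.CommutativeMonoid.Sum +-0-commutativeMonoid
  using (sum; sum-syntax; sum-remove; ∑-comm; sum-cong-≗; sum-replicate-zero)
open import Data.Bool using (Bool; true; false; _∧_)
import Data.Bool.Properties as Bool
open import Data.Fin as Fin using (zero; suc; punchIn; toℕ; fromℕ; inject₁; funToFin; finToFun)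
import Data.Fin.Properties as Fin
open import Data.Fin.Permutation as Perm using (Permutation′; _⟨$⟩ʳ_)
open import Data.Fin.Subset using (∣_∣)
open import Data.Maybe as Maybe using (Maybe; just; nothing; fromMaybe)
open import Data.Nat using (zero; suc; pred; >-nonZero; _^_; _⊓_; _∸_; _<_; _≤?_; z≤n; s≤s; s≤s⁻¹; z<s)
open import Data.Product using (_,_; proj₁; proj₂)
open import Data.Vec as Vec using (Vec; []; _∷_; _++_; tabulate; lookup)
open import Data.Vec.Properties using (tabulate-cong; tabulate∘lookup; lookup∘tabulate; lookup-map; ≡-dec)
open import Data.Sum as Sum using (_⊎_; inj₁; inj₂)
open import Function using (_∘_)
open import Function.Bundles using (_⤖_; Bijection; Inverse; mk⇔)
open import Function.Properties.Inverse using (↔⇒⤖)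
open import Relation.Binary.Definitions using (DecidableEquality)
open import Relation.Binary.PropositionalEquality
  using (_≢_; _≗_; refl; sym; trans; cong; cong₂; subst; subst₂; module ≡-Reasoning)
open import Relation.Nullary using (¬_; Dec; yes; no; does; contradiction)
open import Relation.Nullary.Decidable using (_×-dec_; _⊎-dec_; ¬?; decidable-stable; dec-true; dec-false)

does≡true⇒ : ∀ {P : Set} (P? : Dec P) → does P? ≡ true → P
does≡true⇒ (yes p) _ = p

∑-const : ∀ n c → ∑[ a < n ] c ≡ n * c
∑-const zero    c = refl
∑-const (suc n) c = cong (c +_) (∑-const n c)

∑-single : ∀ {L} (f : Fin L → ℕ) i → (∀ j → j ≢ i → f j ≡ 0) → sum f ≡ f i
∑-single {suc L} f i zero-elsewhere = begin
  sum f                     ≡⟨ sum-remove f ⟩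
  f i + sum (f ∘ punchIn i) ≡⟨ cong (f i +_) (sum-cong-≗ λ j → zero-elsewhere _ (Fin.punchInᵢ≢i i j)) ⟩
  f i + ∑[ j < L ] 0        ≡⟨ cong (f i +_) (sum-replicate-zero L) ⟩
  f i + 0                   ≡⟨ +-identityʳ (f i) ⟩
  f i                       ∎
  where open ≡-Reasoning

∑-cancel : ∀ {L} {f g : Fin (suc L) → ℕ} i → sum f ≡ sum g → (∀ j → j ≢ i → f j ≡ g j) → f i ≡ g i
∑-cancel {f = f} {g} i ∑f≡∑g agree = +-cancelʳ-≡ (sum (f ∘ punchIn i)) _ _ (begin
  f i + sum (f ∘ punchIn i) ≡⟨ sum-remove f ⟨
  sum f                     ≡⟨ ∑f≡∑g ⟩
  sum g                     ≡⟨ sum-remove g ⟩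
  g i + sum (g ∘ punchIn i) ≡⟨ cong (g i +_) (sum-cong-≗ λ j → sym (agree _ (Fin.punchInᵢ≢i i j))) ⟩
  g i + sum (f ∘ punchIn i) ∎)
  where open ≡-Reasoning

∑-mono : ∀ {L} {f g : Fin L → ℕ} → (∀ j → f j ≤ g j) → sum f ≤ sum g
∑-mono {zero}  f≤g = z≤n
∑-mono {suc L} f≤g = +-mono-≤ (f≤g zero) (∑-mono (f≤g ∘ suc))

≤∧∑≡⇒≡ : ∀ {L} {f g : Fin L → ℕ} → (∀ j → f j ≤ g j) → sum f ≡ sum g → ∀ j → f j ≡ g j
≤∧∑≡⇒≡ {suc L} {f} {g} f≤g ∑f≡∑g = pointwise
  where
  open ≤-Reasoning
  head≡ : f zero ≡ g zero
  head≡ = ≤-antisym (f≤g zero) (+-cancelʳ-≤ (sum (g ∘ suc)) _ _ (begin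
    g zero + sum (g ∘ suc) ≡⟨ ∑f≡∑g ⟨
    f zero + sum (f ∘ suc) ≤⟨ +-monoʳ-≤ (f zero) (∑-mono (f≤g ∘ suc)) ⟩
    f zero + sum (g ∘ suc) ∎))
  pointwise : ∀ j → f j ≡ g j
  pointwise zero    = head≡
  pointwise (suc j) =
    ≤∧∑≡⇒≡ (f≤g ∘ suc) (+-cancelˡ-≡ (f zero) _ _ (trans ∑f≡∑g (cong (_+ _) (sym head≡)))) j

bit : Bool → ℕ
bit false = 0
bit true  = 1

bit≤1 : ∀ b → bit b ≤ 1
bit≤1 false = z≤n
bit≤1 true  = s≤s z≤n

-- Agrees definitionally with count (see ofType).
cnt : ∀ {n} → (Fin n → Bool) → ℕ
cnt u = ∣ tabulate u ∣

cnt-suc : ∀ {n} (u : Fin (suc n) → Bool) → cnt u ≡ bit (u zero) + cnt (u ∘ suc)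
cnt-suc u with u zero
... | false = refl
... | true  = refl

cnt≡∑ : ∀ {n} (u : Fin n → Bool) → cnt u ≡ ∑[ a < n ] bit (u a)
cnt≡∑ {zero}  u = refl
cnt≡∑ {suc n} u = trans (cnt-suc u) (cong (bit (u zero) +_) (cnt≡∑ (u ∘ suc)))

cnt-cong : ∀ {n} {u v : Fin n → Bool} → u ≗ v → cnt u ≡ cnt v
cnt-cong u≗v = cong ∣_∣ (tabulate-cong u≗v)

cnt-punchIn : ∀ {n} (u : Fin (suc n) → Bool) c → cnt u ≡ bit (u c) + cnt (u ∘ punchIn c)
cnt-punchIn u c = begin
  cnt u                                 ≡⟨ cnt≡∑ u ⟩
  sum (bit ∘ u)                         ≡⟨ sum-remove {i = c} (bit ∘ u) ⟩
  bit (u c) + sum (bit ∘ u ∘ punchIn c) ≡⟨ cong (bit (u c) +_) (cnt≡∑ (u ∘ punchIn c)) ⟨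
  bit (u c) + cnt (u ∘ punchIn c)       ∎
  where open ≡-Reasoning

cnt≡0 : ∀ {n} (u : Fin n → Bool) → (∀ a → u a ≢ true) → cnt u ≡ 0
cnt≡0 {zero}  u none = refl
cnt≡0 {suc n} u none rewrite Bool.¬-not (none zero) = cnt≡0 (u ∘ suc) (none ∘ suc)

cnt>0 : ∀ {n} (u : Fin n → Bool) {a} → u a ≡ true → 0 < cnt u
cnt>0 u {zero}  ua rewrite ua = s≤s z≤n
cnt>0 u {suc a} ua = ≤-trans (cnt>0 (u ∘ suc) ua) (≤-trans (m≤n+m _ (bit (u zero))) (≤-reflexive (sym (cnt-suc u))))

cnt>0⇒∃ : ∀ {n} (u : Fin n → Bool) → 0 < cnt u → ∃ λ a → u a ≡ true
cnt>0⇒∃ u 0<cnt with Fin.any? (λ a → u a Bool.≟ true)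
... | yes found = found
... | no  none  = contradiction (cnt≡0 u (λ a ua → none (a , ua))) (>⇒≢ 0<cnt)

cnt≤1+cnt : ∀ {n} (u v : Fin (suc n) → Bool) c → (∀ a → a ≢ c → u a ≡ v a) → cnt u ≤ suc (cnt v)
cnt≤1+cnt u v c agree = begin
  cnt u                                 ≡⟨ cnt-punchIn u c ⟩
  bit (u c) + cnt (u ∘ punchIn c)       ≤⟨ +-monoˡ-≤ _ (bit≤1 (u c)) ⟩
  suc (cnt (u ∘ punchIn c))             ≡⟨ cong suc (cnt-cong λ a → agree (punchIn c a) (Fin.punchInᵢ≢i c a)) ⟩
  suc (cnt (v ∘ punchIn c))             ≤⟨ s≤s (m≤n+m _ (bit (v c))) ⟩
  suc (bit (v c) + cnt (v ∘ punchIn c)) ≡⟨ cong suc (cnt-punchIn v c) ⟨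
  suc (cnt v)                           ∎
  where open ≤-Reasoning

_∈_[_,_⟩ : ∀ {A : Set} → A → (ℕ → A) → ℕ → ℕ → Set
a ∈ f [ lo , hi ⟩ = ∃ λ i → i < hi × lo ≤ i × a ≡ f i

_∈?_[_,_⟩ : ∀ {n} (a : Fin n) f lo hi → Dec (a ∈ f [ lo , hi ⟩)
a ∈? f [ lo , hi ⟩ = anyUpTo? (λ i → lo ≤? i ×-dec a Fin.≟ f i) hi

∈-range-mono : ∀ {A : Set} {f : ℕ → A} {a lo hi lo′ hi′} → lo′ ≤ lo → hi ≤ hi′ →
  a ∈ f [ lo , hi ⟩ → a ∈ f [ lo′ , hi′ ⟩
∈-range-mono lo′≤lo hi≤hi′ (i , i<hi , lo≤i , a≡fi) =
  i , ≤-trans i<hi hi≤hi′ , ≤-trans lo′≤lo lo≤i , a≡fi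

∈-range-split : ∀ {A : Set} {f : ℕ → A} {a lo mid hi} → a ∈ f [ lo , hi ⟩ → ¬ a ∈ f [ lo , mid ⟩ →
  a ∈ f [ mid , hi ⟩
∈-range-split (i , i<hi , lo≤i , a≡fi) a∉ =
  i , i<hi , ≮⇒≥ (λ i<mid → a∉ (i , i<mid , lo≤i , a≡fi)) , a≡fi

⊆-range⇒cnt≤ : ∀ {n} (u : Fin n → Bool) (f : ℕ → Fin n) m → (∀ a → u a ≡ true → a ∈ f [ 0 , m ⟩) →
  cnt u ≤ m
⊆-range⇒cnt≤ u f zero covered = ≤-reflexive (cnt≡0 u λ a ua → n≮0 (proj₁ (proj₂ (covered a ua))))
⊆-range⇒cnt≤ {zero} u f (suc m) covered = z≤n
⊆-range⇒cnt≤ {suc n} u f (suc m) covered =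
  ≤-trans (cnt≤1+cnt u u′ (f m) u≡u′) (s≤s (⊆-range⇒cnt≤ u′ f m covered′))
  where
  u′ : Fin (suc n) → Bool
  u′ a = does (¬? (a Fin.≟ f m)) ∧ u a
  u≡u′ : ∀ a → a ≢ f m → u a ≡ u′ a
  u≡u′ a a≢fm rewrite dec-true (¬? (a Fin.≟ f m)) a≢fm = refl
  covered′ : ∀ a → u′ a ≡ true → a ∈ f [ 0 , m ⟩
  covered′ a u′a with a Fin.≟ f m
  ... | no a≢fm with covered a u′a
  ...   | i , i<1+m , _ , a≡fi =
          i , ≤∧≢⇒< (s≤s⁻¹ i<1+m) (λ { refl → a≢fm a≡fi }) , z≤n , a≡fi

cnt>⇒∉-range : ∀ {n} (u : Fin n → Bool) (f : ℕ → Fin n) m → m < cnt u →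
  ∃ λ a → u a ≡ true × ¬ a ∈ f [ 0 , m ⟩
cnt>⇒∉-range u f m m<cnt with Fin.any? (λ a → u a Bool.≟ true ×-dec ¬? (a ∈? f [ 0 , m ⟩))
... | yes found = found
... | no  none  = contradiction (⊆-range⇒cnt≤ u f m covered) (<⇒≱ m<cnt)
  where
  covered : ∀ a → u a ≡ true → a ∈ f [ 0 , m ⟩
  covered a ua = decidable-stable (a ∈? f [ 0 , m ⟩) λ a∉ → none (a , ua , a∉)

enum : ∀ {n} → (Fin n → Bool) → ℕ → Maybe (Fin n)
enum {zero}  u i = nothing
enum {suc n} u i with u zero | i
... | true  | zero  = just zero
... | true  | suc j = Maybe.map suc (enum (u ∘ suc) j)
... | false | j     = Maybe.map suc (enum (u ∘ suc) j)

enum-complete : ∀ {n} (u : Fin n → Bool) {a} → u a ≡ true → ∃ λ i → i < cnt u × enum u i ≡ just a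
enum-complete u {zero} ua rewrite ua = zero , s≤s z≤n , refl
enum-complete u {suc a} ua with enum-complete (u ∘ suc) ua
... | i , i<cnt , enum≡a with u zero
...   | true  = suc i , s≤s i<cnt , cong (Maybe.map suc) enum≡a
...   | false = i , i<cnt , cong (Maybe.map suc) enum≡a

enumerate : ∀ {n} → Fin n → (Fin n → Bool) → ℕ → Fin n
enumerate default u i = fromMaybe default (enum u i)

enumerate-complete : ∀ {n} default (u : Fin n → Bool) {a} → u a ≡ true → a ∈ enumerate default u [ 0 , cnt u ⟩
enumerate-complete default u ua with enum-complete u ua
... | i , i<cnt , enum≡a = i , i<cnt , z≤n , sym (cong (fromMaybe default) enum≡a)

module _ {A : Set} (_≟_ : DecidableEquality A) where

  fibre : ∀ {n} → (Fin n → A) → A → Fin n → Bool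
  fibre t v a = does (t a ≟ v)

  ∑-cnt-fibres : ∀ {n L} (t : Fin n → A) (π : Fin L → A) → Injective _≡_ _≡_ π →
    (∀ a → ∃ λ j → t a ≡ π j) → ∑[ j < L ] cnt (fibre t (π j)) ≡ n
  ∑-cnt-fibres {n} {L} t π π-inj covers = begin
    ∑[ j < L ] cnt (fibre t (π j))              ≡⟨ sum-cong-≗ (λ j → cnt≡∑ (fibre t (π j))) ⟩
    ∑[ j < L ] ∑[ a < n ] bit (fibre t (π j) a) ≡⟨ ∑-comm (λ j a → bit (fibre t (π j) a)) ⟩
    ∑[ a < n ] ∑[ j < L ] bit (fibre t (π j) a) ≡⟨ sum-cong-≗ exactly-one ⟩
    ∑[ a < n ] 1                                ≡⟨ ∑-const n 1 ⟩
    n * 1                                       ≡⟨ *-identityʳ n ⟩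
    n                                           ∎
    where
    open ≡-Reasoning
    exactly-one : ∀ a → ∑[ j < L ] bit (fibre t (π j) a) ≡ 1
    exactly-one a with covers a
    ... | j₀ , ta≡πj₀ = trans
      (∑-single _ j₀ λ j j≢j₀ → cong bit (dec-false (t a ≟ π j) λ ta≡πj →
        j≢j₀ (π-inj (trans (sym ta≡πj) ta≡πj₀))))
      (cong bit (dec-true (t a ≟ π j₀) ta≡πj₀))

  equinumerous-fibres⇒permutation : ∀ {n} (t t′ : Fin n → A) → (∀ v → cnt (fibre t′ v) ≡ cnt (fibre t v)) →
    ∃ λ (σ : Permutation′ n) → ∀ a → t′ a ≡ t (σ ⟨$⟩ʳ a)
  equinumerous-fibres⇒permutation {zero}  t t′ same = Perm.id , λ ()
  equinumerous-fibres⇒permutation {suc n} t t′ same = Perm.insert zero b σ , matches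
    where
    v = t′ zero
    t-hits-v : ∃ λ b → fibre t v b ≡ true
    t-hits-v = cnt>0⇒∃ (fibre t v) (subst (0 <_) (same v) (cnt>0 (fibre t′ v) (dec-true (v ≟ v) refl)))
    b = proj₁ t-hits-v
    tb≡v : t b ≡ v
    tb≡v = does≡true⇒ (t b ≟ v) (proj₂ t-hits-v)
    same′ : ∀ w → cnt (fibre (t′ ∘ suc) w) ≡ cnt (fibre (t ∘ punchIn b) w)
    same′ w = +-cancelˡ-≡ (bit (fibre t′ w zero)) _ _ (begin
      bit (fibre t′ w zero) + cnt (fibre (t′ ∘ suc) w)     ≡⟨ cnt-suc (fibre t′ w) ⟨
      cnt (fibre t′ w)                                     ≡⟨ same w ⟩
      cnt (fibre t w)                                      ≡⟨ cnt-punchIn (fibre t w) b ⟩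
      bit (fibre t w b) + cnt (fibre (t ∘ punchIn b) w)    ≡⟨ cong (λ x → bit (does (x ≟ w)) + others) tb≡v ⟩
      bit (fibre t′ w zero) + cnt (fibre (t ∘ punchIn b) w) ∎)
      where
      open ≡-Reasoning
      others = cnt (fibre (t ∘ punchIn b) w)
    rest : ∃ λ (σ : Permutation′ n) → ∀ a → t′ (suc a) ≡ t (punchIn b (σ ⟨$⟩ʳ a))
    rest = equinumerous-fibres⇒permutation (t ∘ punchIn b) (t′ ∘ suc) same′
    σ = proj₁ rest
    matches : ∀ a → t′ a ≡ t (Perm.insert zero b σ ⟨$⟩ʳ a)
    matches zero    = sym tb≡v
    matches (suc a) = trans (proj₂ rest a) (cong t (sym (Perm.insert-punchIn zero b σ a)))

_≟ᵀ_ : ∀ {k} → DecidableEquality (TypeT k)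
_≟ᵀ_ = ≡-dec Bool._≟_

Covers : ∀ {k n L} → Model k n → (Fin L → TypeT k) → Set
Covers M π = ∀ a → ∃ λ j → Realizes M a (π j)

count-total : ∀ {k n L} (M : Model k n) {π : Fin L → TypeT k} → Injective _≡_ _≡_ π → Covers M π →
  ∑[ j < L ] count M (π j) ≡ n
count-total M π-inj covers = ∑-cnt-fibres _≟ᵀ_ (typeOf M) _ π-inj covers

ofType : ∀ {k n} → Model k n → TypeT k → Fin n → Bool
ofType M = fibre _≟ᵀ_ (typeOf M)

ofType⁻ : ∀ {k n} (M : Model k n) {v a} → ofType M v a ≡ true → typeOf M a ≡ v
ofType⁻ M {v} {a} = does≡true⇒ (typeOf M a ≟ᵀ v)

ofType⁺ : ∀ {k n} (M : Model k n) {v a} → typeOf M a ≡ v → ofType M v a ≡ true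
ofType⁺ M {v} {a} = dec-true (typeOf M a ≟ᵀ v)

count-absent : ∀ {k n} (M : Model k n) {v} → (∀ a → typeOf M a ≢ v) → count M v ≡ 0
count-absent M absent = cnt≡0 (ofType M _) λ a a:v → absent a (ofType⁻ M a:v)

count-uncovered : ∀ {k n L} (M : Model k n) {π : Fin L → TypeT k} {v} → Covers M π → (∀ j → π j ≢ v) →
  count M v ≡ 0
count-uncovered M covers v∉π =
  count-absent M λ a a:v → let (j , a:πj) = covers a in v∉π j (trans (sym a:πj) a:v)

≅-from-counts : ∀ {k n} (M M′ : Model k n) → (∀ v → count M′ v ≡ count M v) → M′ ≅ M
≅-from-counts M M′ same with equinumerous-fibres⇒permutation _≟ᵀ_ (typeOf M) (typeOf M′) same
... | σ , types≡ = ↔⇒⤖ σ , λ i a → begin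
  lookup (rel M′ i) a              ≡⟨ lookup∘tabulate (λ i → lookup (rel M′ i) a) i ⟨
  lookup (typeOf M′ a) i           ≡⟨ cong (λ v → lookup v i) (types≡ a) ⟩
  lookup (typeOf M (σ ⟨$⟩ʳ a)) i   ≡⟨ lookup∘tabulate (λ i → lookup (rel M i) (σ ⟨$⟩ʳ a)) i ⟩
  lookup (rel M i) (σ ⟨$⟩ʳ a)      ∎
  where open ≡-Reasoning

≅-from-type-counts : ∀ {k n L} (M M′ : Model k n) {π : Fin L → TypeT k} → Covers M π → Covers M′ π →
  (∀ j → count M′ (π j) ≡ count M (π j)) → M′ ≅ M
≅-from-type-counts M M′ {π} covers covers′ same = ≅-from-counts M M′ same-everywhere
  where
  same-everywhere : ∀ v → count M′ v ≡ count M v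
  same-everywhere v with Fin.any? (λ j → π j ≟ᵀ v)
  ... | yes (j , refl) = same j
  ... | no  v∉π        = trans (count-uncovered M′ covers′ (λ j e → v∉π (j , e)))
                               (sym (count-uncovered M covers (λ j e → v∉π (j , e))))

module _ {k n} {M M′ : Model k n} (f : Fin n ⤖ Fin n)
         (f-hom : ∀ i a → lookup (rel M′ i) a ≡ lookup (rel M i) (Bijection.to f a)) where
  open Bijection f using (to; injective; strictlySurjective)

  Sat-≅ : ∀ {m} (φ : Formula k m) ρ → Sat M (Vec.map to ρ) φ → Sat M′ ρ φ
  Sat-≅ (eq x y) ρ s = injective (trans (sym (lookup-map x to ρ)) (trans s (lookup-map y to ρ)))
  Sat-≅ (neq x y) ρ s x≡y = s (trans (lookup-map x to ρ) (trans (cong to x≡y) (sym (lookup-map y to ρ))))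
  Sat-≅ (pos P x) ρ s = trans (f-hom P _) (trans (cong (lookup (rel M P)) (sym (lookup-map x to ρ))) s)
  Sat-≅ (neg P x) ρ s = trans (f-hom P _) (trans (cong (lookup (rel M P)) (sym (lookup-map x to ρ))) s)
  Sat-≅ (φ ∧f ψ) ρ (s , t) = Sat-≅ φ ρ s , Sat-≅ ψ ρ t
  Sat-≅ (φ ∨f ψ) ρ (inj₁ s) = inj₁ (Sat-≅ φ ρ s)
  Sat-≅ (φ ∨f ψ) ρ (inj₂ t) = inj₂ (Sat-≅ ψ ρ t)
  Sat-≅ (exf φ) ρ (b , s) with strictlySurjective b
  ... | a , refl = a , Sat-≅ φ (a ∷ ρ) s
  Sat-≅ (allf φ) ρ s a = Sat-≅ φ (a ∷ ρ) (s (to a))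

DefinableWithin : ∀ {k n} → Model k n → ℕ → Set
DefinableWithin {k} M b = Σ (Sentence k) λ φ → Defines φ M × size φ ≤ b

DefinableWithin-mono : ∀ {k n} {M : Model k n} {b b′} → b ≤ b′ → DefinableWithin M b → DefinableWithin M b′
DefinableWithin-mono b≤b′ (φ , φ-defines , size≤b) = φ , φ-defines , ≤-trans size≤b b≤b′

DefinableWithin-⊓ : ∀ {k n} {M : Model k n} {b b′} → DefinableWithin M b → DefinableWithin M b′ →
  DefinableWithin M (b ⊓ b′)
DefinableWithin-⊓ {M = M} {b} {b′} φ ψ with ≤-total b b′
... | inj₁ b≤b′ = DefinableWithin-mono {M = M} (≤-reflexive (sym (m≤n⇒m⊓n≡m b≤b′))) φ
... | inj₂ b′≤b = DefinableWithin-mono {M = M} (≤-reflexive (sym (m≥n⇒m⊓n≡n b′≤b))) ψ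

defines : ∀ {k n} {M : Model k n} {φ : Sentence k} → M ⊨ φ → (∀ M′ → M′ ⊨ φ → M′ ≅ M) →
  Defines φ M
defines M⊨φ only-M M′ = mk⇔ (only-M M′) λ (f , f-hom) → Sat-≅ f f-hom _ [] M⊨φ

Sat? : ∀ {k n m} (N : Model k n) (ρ : Vec (Fin n) m) (φ : Formula k m) → Dec (Sat N ρ φ)
Sat? N ρ (eq x y)  = lookup ρ x Fin.≟ lookup ρ y
Sat? N ρ (neq x y) = ¬? (lookup ρ x Fin.≟ lookup ρ y)
Sat? N ρ (pos P x) = lookup (rel N P) (lookup ρ x) Bool.≟ true
Sat? N ρ (neg P x) = lookup (rel N P) (lookup ρ x) Bool.≟ false
Sat? N ρ (φ ∧f ψ)  = Sat? N ρ φ ×-dec Sat? N ρ ψ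
Sat? N ρ (φ ∨f ψ)  = Sat? N ρ φ ⊎-dec Sat? N ρ ψ
Sat? N ρ (exf φ)   = Fin.any? λ a → Sat? N (a ∷ ρ) φ
Sat? N ρ (allf φ)  = Fin.all? λ a → Sat? N (a ∷ ρ) φ

infix 25 ∼_
∼_ : ∀ {k m} → Formula k m → Formula k m
∼ eq x y   = neq x y
∼ neq x y  = eq x y
∼ pos P x  = neg P x
∼ neg P x  = pos P x
∼ (φ ∧f ψ) = ∼ φ ∨f ∼ ψ
∼ (φ ∨f ψ) = ∼ φ ∧f ∼ ψ
∼ exf φ    = allf (∼ φ)
∼ allf φ   = exf (∼ φ)

size-∼ : ∀ {k m} (φ : Formula k m) → size (∼ φ) ≡ size φ
size-∼ (eq x y)  = refl
size-∼ (neq x y) = refl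
size-∼ (pos P x) = refl
size-∼ (neg P x) = refl
size-∼ (φ ∧f ψ)  = cong₂ (λ a b → suc (a + b)) (size-∼ φ) (size-∼ ψ)
size-∼ (φ ∨f ψ)  = cong₂ (λ a b → suc (a + b)) (size-∼ φ) (size-∼ ψ)
size-∼ (exf φ)   = cong suc (size-∼ φ)
size-∼ (allf φ)  = cong suc (size-∼ φ)

module _ {k n} (N : Model k n) where

  Sat-∼⁻ : ∀ {m} (φ : Formula k m) {ρ} → Sat N ρ (∼ φ) → ¬ Sat N ρ φ
  Sat-∼⁻ (eq x y)  s t = s t
  Sat-∼⁻ (neq x y) s t = t s
  Sat-∼⁻ (pos P x) s t = Bool.not-¬ t s
  Sat-∼⁻ (neg P x) s t = Bool.not-¬ s t
  Sat-∼⁻ (φ ∧f ψ) (inj₁ s) (t , _) = Sat-∼⁻ φ s t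
  Sat-∼⁻ (φ ∧f ψ) (inj₂ s) (_ , t) = Sat-∼⁻ ψ s t
  Sat-∼⁻ (φ ∨f ψ) (s , _) (inj₁ t) = Sat-∼⁻ φ s t
  Sat-∼⁻ (φ ∨f ψ) (_ , s) (inj₂ t) = Sat-∼⁻ ψ s t
  Sat-∼⁻ (exf φ)  s (a , t) = Sat-∼⁻ φ (s a) t
  Sat-∼⁻ (allf φ) (a , s) t = Sat-∼⁻ φ s (t a)

  -- Needs excluded middle for Sat, which holds because the domain is finite (Sat?).
  Sat-∼⁺ : ∀ {m} (φ : Formula k m) {ρ} → ¬ Sat N ρ φ → Sat N ρ (∼ φ)
  Sat-∼⁺ (eq x y)  ¬t = ¬t
  Sat-∼⁺ (neq x y) ¬t = decidable-stable (_ Fin.≟ _) ¬t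
  Sat-∼⁺ (pos P x) ¬t = Bool.¬-not ¬t
  Sat-∼⁺ (neg P x) ¬t = Bool.¬-not ¬t
  Sat-∼⁺ (φ ∧f ψ) {ρ} ¬t with Sat? N ρ φ
  ... | yes t = inj₂ (Sat-∼⁺ ψ λ u → ¬t (t , u))
  ... | no ¬u = inj₁ (Sat-∼⁺ φ ¬u)
  Sat-∼⁺ (φ ∨f ψ) ¬t = Sat-∼⁺ φ (¬t ∘ inj₁) , Sat-∼⁺ ψ (¬t ∘ inj₂)
  Sat-∼⁺ (exf φ)  ¬t a = Sat-∼⁺ φ λ t → ¬t (a , t)
  Sat-∼⁺ (allf φ) {ρ} ¬t with Fin.¬∀⟶∃¬ n _ (λ a → Sat? N (a ∷ ρ) φ) ¬t
  ... | a , ¬u = a , Sat-∼⁺ φ ¬u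

lit : ∀ {k m} → Fin k → Bool → Fin m → Formula k m
lit P true  x = pos P x
lit P false x = neg P x

-- Nonempty only, so that no dummy conjunct adds to the size; hence the type formulas below assume
-- a nonempty vocabulary of suc k symbols.
⋀ : ∀ {k m} j → (Fin (suc j) → Formula k m) → Formula k m
⋀ zero    f = f zero
⋀ (suc j) f = f zero ∧f ⋀ j (f ∘ suc)

⋁ : ∀ {k m} j → (Fin (suc j) → Formula k m) → Formula k m
⋁ zero    f = f zero
⋁ (suc j) f = f zero ∨f ⋁ j (f ∘ suc)

size-⋀ : ∀ {k m} j (f : Fin (suc j) → Formula k m) {s} → (∀ i → size (f i) ≡ s) →
  size (⋀ j f) ≡ s + j * suc s
size-⋀ zero    f {s} size≡ = trans (size≡ zero) (sym (+-identityʳ s))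
size-⋀ (suc j) f {s} size≡ =
  trans (cong₂ (λ a b → suc (a + b)) (size≡ zero) (size-⋀ j (f ∘ suc) (size≡ ∘ suc))) (sym (+-suc s _))

size-⋁ : ∀ {k m} j (f : Fin (suc j) → Formula k m) {s} → (∀ i → size (f i) ≡ s) →
  size (⋁ j f) ≡ s + j * suc s
size-⋁ zero    f {s} size≡ = trans (size≡ zero) (sym (+-identityʳ s))
size-⋁ (suc j) f {s} size≡ =
  trans (cong₂ (λ a b → suc (a + b)) (size≡ zero) (size-⋁ j (f ∘ suc) (size≡ ∘ suc))) (sym (+-suc s _))

hasType : ∀ {k m} → TypeT (suc k) → Fin m → Formula (suc k) m
hasType {k} π x = ⋀ k λ P → lit P (lookup π P) x

sameType : ∀ {k m} → Fin m → Fin m → Formula (suc k) m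
sameType {k} x y = ⋀ k λ P → (pos P x ∧f pos P y) ∨f (neg P x ∧f neg P y)

size-hasType : ∀ {k m} (π : TypeT (suc k)) (x : Fin m) → size (hasType π x) ≡ 1 + k * 2
size-hasType {k} π x = size-⋀ k _ λ P → size-lit P (lookup π P)
  where
  size-lit : ∀ P b → size (lit {m = _} P b x) ≡ 1
  size-lit P true  = refl
  size-lit P false = refl

size-sameType : ∀ {k m} (x y : Fin m) → size (sameType {k} x y) ≡ 7 + k * 8
size-sameType {k} x y = size-⋀ k _ λ P → refl

module _ {k n} (N : Model k n) where

  Sat-⋀⁻ : ∀ {m} {ρ : Vec (Fin n) m} j f → Sat N ρ (⋀ j f) → ∀ i → Sat N ρ (f i)
  Sat-⋀⁻ zero    f s       zero    = s
  Sat-⋀⁻ (suc j) f (s , _) zero    = s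
  Sat-⋀⁻ (suc j) f (_ , s) (suc i) = Sat-⋀⁻ j (f ∘ suc) s i

  Sat-⋀⁺ : ∀ {m} {ρ : Vec (Fin n) m} j f → (∀ i → Sat N ρ (f i)) → Sat N ρ (⋀ j f)
  Sat-⋀⁺ zero    f s = s zero
  Sat-⋀⁺ (suc j) f s = s zero , Sat-⋀⁺ j (f ∘ suc) (s ∘ suc)

  Sat-⋁⁻ : ∀ {m} {ρ : Vec (Fin n) m} j f → Sat N ρ (⋁ j f) → ∃ λ i → Sat N ρ (f i)
  Sat-⋁⁻ zero    f s        = zero , s
  Sat-⋁⁻ (suc j) f (inj₁ s) = zero , s
  Sat-⋁⁻ (suc j) f (inj₂ s) = let (i , t) = Sat-⋁⁻ j (f ∘ suc) s in suc i , t

  Sat-⋁⁺ : ∀ {m} {ρ : Vec (Fin n) m} j f i → Sat N ρ (f i) → Sat N ρ (⋁ j f)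
  Sat-⋁⁺ zero    f zero    s = s
  Sat-⋁⁺ (suc j) f zero    s = inj₁ s
  Sat-⋁⁺ (suc j) f (suc i) s = inj₂ (Sat-⋁⁺ j (f ∘ suc) i s)

lookup-typeOf : ∀ {k n} (N : Model k n) a P → lookup (typeOf N a) P ≡ lookup (rel N P) a
lookup-typeOf N a = lookup∘tabulate (λ P → lookup (rel N P) a)

module _ {k n} (N : Model (suc k) n) {m} {ρ : Vec (Fin n) m} where

  Sat-hasType⁻ : ∀ π x → Sat N ρ (hasType π x) → typeOf N (lookup ρ x) ≡ π
  Sat-hasType⁻ π x s =
    trans (tabulate-cong λ P → Sat-lit⁻ P (lookup π P) (Sat-⋀⁻ N k _ s P)) (tabulate∘lookup π)
    where
    Sat-lit⁻ : ∀ P b → Sat N ρ (lit P b x) → lookup (rel N P) (lookup ρ x) ≡ b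
    Sat-lit⁻ P true  s = s
    Sat-lit⁻ P false s = s

  Sat-hasType⁺ : ∀ π x → typeOf N (lookup ρ x) ≡ π → Sat N ρ (hasType π x)
  Sat-hasType⁺ π x x:π = Sat-⋀⁺ N k _ λ P →
    Sat-lit⁺ P (lookup π P) (trans (sym (lookup-typeOf N _ P)) (cong (λ v → lookup v P) x:π))
    where
    Sat-lit⁺ : ∀ P b → lookup (rel N P) (lookup ρ x) ≡ b → Sat N ρ (lit P b x)
    Sat-lit⁺ P true  s = s
    Sat-lit⁺ P false s = s

  Sat-sameType⁻ : ∀ x y → Sat N ρ (sameType x y) → typeOf N (lookup ρ x) ≡ typeOf N (lookup ρ y)
  Sat-sameType⁻ x y s = tabulate-cong λ P → agree P (Sat-⋀⁻ N k _ s P)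
    where
    agree : ∀ P → Sat N ρ ((pos P x ∧f pos P y) ∨f (neg P x ∧f neg P y)) →
      lookup (rel N P) (lookup ρ x) ≡ lookup (rel N P) (lookup ρ y)
    agree P (inj₁ (x∈P , y∈P)) = trans x∈P (sym y∈P)
    agree P (inj₂ (x∉P , y∉P)) = trans x∉P (sym y∉P)

  Sat-sameType⁺ : ∀ x y → typeOf N (lookup ρ x) ≡ typeOf N (lookup ρ y) → Sat N ρ (sameType x y)
  Sat-sameType⁺ x y x~y = Sat-⋀⁺ N k _ λ P → agree P (begin
    lookup (rel N P) (lookup ρ x) ≡⟨ lookup-typeOf N _ P ⟨
    lookup (typeOf N (lookup ρ x)) P ≡⟨ cong (λ v → lookup v P) x~y ⟩
    lookup (typeOf N (lookup ρ y)) P ≡⟨ lookup-typeOf N _ P ⟩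
    lookup (rel N P) (lookup ρ y) ∎)
    where
    open ≡-Reasoning
    agree : ∀ P → lookup (rel N P) (lookup ρ x) ≡ lookup (rel N P) (lookup ρ y) →
      Sat N ρ ((pos P x ∧f pos P y) ∨f (neg P x ∧f neg P y))
    agree P same with lookup (rel N P) (lookup ρ x)
    ... | true  = inj₁ (refl , sym same)
    ... | false = inj₂ (refl , sym same)

module _ {k m : ℕ} (y : Fin m) (x : ℕ → Fin m) where

  eqAny : ℕ → ℕ → Formula k m
  eqAny lo zero    = neq y y
  eqAny lo (suc d) = eq y (x lo) ∨f eqAny (suc lo) d

  among : ℕ → ℕ → Formula k m
  among lo hi = eqAny lo (hi ∸ lo)

  size-among : ∀ lo hi → size (among lo hi) ≡ 1 + (hi ∸ lo) * 2
  size-among lo hi = size-eqAny lo (hi ∸ lo)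
    where
    size-eqAny : ∀ lo d → size (eqAny lo d) ≡ 1 + d * 2
    size-eqAny lo zero    = refl
    size-eqAny lo (suc d) = cong (2 +_) (size-eqAny (suc lo) d)

  module _ {n} (N : Model k n) (ρ : Vec (Fin n) m) where
    private
      Y = lookup ρ y
      X = λ i → lookup ρ (x i)

    Sat-eqAny⁻ : ∀ lo d → Sat N ρ (eqAny lo d) → Y ∈ X [ lo , lo + d ⟩
    Sat-eqAny⁻ lo zero    Y≢Y = contradiction refl Y≢Y
    Sat-eqAny⁻ lo (suc d) (inj₁ Y≡Xlo) = lo , m<m+n lo z<s , ≤-refl , Y≡Xlo
    Sat-eqAny⁻ lo (suc d) (inj₂ s) =
      ∈-range-mono (n≤1+n lo) (≤-reflexive (sym (+-suc lo d))) (Sat-eqAny⁻ (suc lo) d s)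

    Sat-eqAny⁺ : ∀ lo d → Y ∈ X [ lo , lo + d ⟩ → Sat N ρ (eqAny lo d)
    Sat-eqAny⁺ lo zero    (i , i<lo+0 , lo≤i , _) = contradiction (subst (i <_) (+-identityʳ lo) i<lo+0) (≤⇒≯ lo≤i)
    Sat-eqAny⁺ lo (suc d) (i , i<hi , lo≤i , Y≡Xi) with lo ≟ i
    ... | yes refl = inj₁ Y≡Xi
    ... | no  lo≢i =
      inj₂ (Sat-eqAny⁺ (suc lo) d (i , subst (i <_) (+-suc lo d) i<hi , ≤∧≢⇒< lo≤i lo≢i , Y≡Xi))

    Sat-among⁻ : ∀ {lo hi} → lo ≤ hi → Sat N ρ (among lo hi) → Y ∈ X [ lo , hi ⟩
    Sat-among⁻ {lo} {hi} lo≤hi s =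
      subst (λ b → Y ∈ X [ lo , b ⟩) (m+[n∸m]≡n lo≤hi) (Sat-eqAny⁻ lo (hi ∸ lo) s)

    Sat-among⁺ : ∀ {lo hi} → Y ∈ X [ lo , hi ⟩ → Sat N ρ (among lo hi)
    Sat-among⁺ {lo} {hi} Y∈@(i , i<hi , lo≤i , _) =
      Sat-eqAny⁺ lo (hi ∸ lo)
        (subst (λ b → Y ∈ X [ lo , b ⟩) (sym (m+[n∸m]≡n (≤-trans lo≤i (<⇒≤ i<hi)))) Y∈)

Sorted : ∀ {L} → (Fin L → ℕ) → Set
Sorted h = ∀ i j → i ≤F j → h i ≤ h j

Sorted-suc : ∀ {L} {h : Fin (suc L) → ℕ} → Sorted h → Sorted (h ∘ suc)
Sorted-suc sorted i j i≤j = sorted (suc i) (suc j) (s≤s i≤j)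

Sorted-inject₁ : ∀ {L} {h : Fin (suc L) → ℕ} → Sorted h → Sorted (h ∘ inject₁)
Sorted-inject₁ sorted i j i≤j =
  sorted (inject₁ i) (inject₁ j) (subst₂ _≤_ (sym (Fin.toℕ-inject₁ i)) (sym (Fin.toℕ-inject₁ j)) i≤j)

Sorted-pred : ∀ {L} {h : Fin L → ℕ} → Sorted h → Sorted (pred ∘ h)
Sorted-pred sorted i j i≤j = pred-mono-≤ (sorted i j i≤j)

Sorted-≤last : ∀ {L} {h : Fin (suc L) → ℕ} → Sorted h → ∀ j → h j ≤ h (fromℕ L)
Sorted-≤last sorted j = sorted j (fromℕ _) (Fin.≤fromℕ j)

-- The ranges [lo , h 0), [h 0 , h 1), … of consecutive types are disjoint, so every equality
-- y = xᵢ occurs once and the size is linear in the largest h s (size-chain), not in their sum.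
module _ {k m : ℕ} (y z : Fin m) (x : ℕ → Fin m) where

  chain : ∀ L → (Fin L → TypeT (suc k)) → (Fin L → ℕ) → ℕ → Formula (suc k) m → Formula (suc k) m
  chain zero    π h lo F = F
  chain (suc L) π h lo F =
    among y x lo (h zero) ∨f (∼ hasType (π zero) z ∧f chain L (π ∘ suc) (h ∘ suc) (h zero) F)

  module _ {n} (N : Model (suc k) n) (ρ : Vec (Fin n) m) where
    private
      Y = lookup ρ y
      Z = lookup ρ z
      X = λ i → lookup ρ (x i)

    chain-sound : ∀ {L π h lo F} → Sorted h → (∀ s → lo ≤ h s) → Sat N ρ (chain L π h lo F) →
      ∀ s → typeOf N Z ≡ π s → Y ∈ X [ lo , h s ⟩
    chain-sound {suc L} sorted lo≤h (inj₁ Y∈) s _ =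
      ∈-range-mono ≤-refl (sorted zero s z≤n) (Sat-among⁻ y x N ρ (lo≤h zero) Y∈)
    chain-sound {suc L} {π} sorted lo≤h (inj₂ (Z∉π₀ , _)) zero Z:π₀ =
      contradiction (Sat-hasType⁺ N (π zero) z Z:π₀) (Sat-∼⁻ N _ Z∉π₀)
    chain-sound {suc L} sorted lo≤h (inj₂ (_ , rest)) (suc s) Z:πs =
      ∈-range-mono (lo≤h zero) ≤-refl
        (chain-sound (Sorted-suc sorted) (λ s → sorted zero (suc s) z≤n) rest s Z:πs)

    chain-base : ∀ {L π h lo F B} → Sorted h → (∀ s → lo ≤ h s) → (∀ s → h s ≤ B) →
      Sat N ρ (chain L π h lo F) → (∀ s → typeOf N Z ≢ π s) → Sat N ρ F ⊎ Y ∈ X [ lo , B ⟩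
    chain-base {zero} sorted lo≤h h≤B sF untyped = inj₁ sF
    chain-base {suc L} sorted lo≤h h≤B (inj₁ Y∈) untyped =
      inj₂ (∈-range-mono ≤-refl (h≤B zero) (Sat-among⁻ y x N ρ (lo≤h zero) Y∈))
    chain-base {suc L} sorted lo≤h h≤B (inj₂ (_ , rest)) untyped =
      Sum.map₂ (∈-range-mono (lo≤h zero) ≤-refl)
        (chain-base (Sorted-suc sorted) (λ s → sorted zero (suc s) z≤n) (h≤B ∘ suc) rest (untyped ∘ suc))

    chain-complete : ∀ {L π h lo F} → (∀ s → typeOf N Z ≡ π s → Y ∈ X [ lo , h s ⟩) →
      ((∀ s → typeOf N Z ≢ π s) → Sat N ρ F) → Sat N ρ (chain L π h lo F)
    chain-complete {zero} typed base = base λ ()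
    chain-complete {suc L} {π} {h} {lo} typed base with Y ∈? X [ lo , h zero ⟩
    ... | yes Y∈ = inj₁ (Sat-among⁺ y x N ρ Y∈)
    ... | no  Y∉ = inj₂ (Sat-∼⁺ N _ (Z∉π₀ ∘ Sat-hasType⁻ N (π zero) z) ,
                         chain-complete (λ s Z:πs → ∈-range-split (typed (suc s) Z:πs) Y∉) base′)
      where
      Z∉π₀ : typeOf N Z ≢ π zero
      Z∉π₀ = Y∉ ∘ typed zero
      base′ : (∀ s → typeOf N Z ≢ π (suc s)) → _
      base′ untyped = base λ { zero → Z∉π₀ ; (suc s) → untyped s }

    cochain-sound : ∀ {L π h lo F} → Injective _≡_ _≡_ π → Sat N ρ (∼ chain L π h lo (∼ F)) →
      ∀ s → typeOf N Z ≡ π s → ¬ Y ∈ X [ lo , h s ⟩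
    cochain-sound {h = h} {lo} π-inj sat s Z:πs Y∈ = Sat-∼⁻ N _ sat (chain-complete
      (λ t Z:πt → subst (λ u → Y ∈ X [ lo , h u ⟩) (π-inj (trans (sym Z:πs) Z:πt)) Y∈)
      (λ untyped → contradiction Z:πs (untyped s)))

    cochain-base : ∀ {L π h lo F} → Sat N ρ (∼ chain L π h lo (∼ F)) → (∀ s → typeOf N Z ≢ π s) →
      Sat N ρ F
    cochain-base {F = F} sat untyped = decidable-stable (Sat? N ρ F) λ ¬F → Sat-∼⁻ N _ sat
      (chain-complete (λ s Z:πs → contradiction Z:πs (untyped s)) (λ _ → Sat-∼⁺ N F ¬F))

    cochain-complete : ∀ {L π h lo F B} → Sorted h → (∀ s → lo ≤ h s) → (∀ s → h s ≤ B) →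
      (∀ s → typeOf N Z ≡ π s → ¬ Y ∈ X [ lo , h s ⟩) →
      ((∀ s → typeOf N Z ≢ π s) → Sat N ρ F × ¬ Y ∈ X [ lo , B ⟩) →
      Sat N ρ (∼ chain L π h lo (∼ F))
    cochain-complete {L} {π} {h} {lo} {F} sorted lo≤h h≤B typed base = Sat-∼⁺ N _ refute
      where
      refute : ¬ Sat N ρ (chain L π h lo (∼ F))
      refute sat with Fin.any? (λ s → typeOf N Z ≟ᵀ π s)
      ... | yes (s , Z:πs) = typed s Z:πs (chain-sound sorted lo≤h sat s Z:πs)
      ... | no  ¬typed with base (λ s e → ¬typed (s , e))
                          | chain-base sorted lo≤h h≤B sat (λ s e → ¬typed (s , e))
      ...   | sF , _  | inj₁ s∼F = Sat-∼⁻ N F s∼F sF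
      ...   | _  , Y∉ | inj₂ Y∈  = Y∉ Y∈

  size-chain : ∀ {L π h lo F B} → Sorted h → (∀ s → lo ≤ h s) → (∀ s → h s ≤ B) → lo ≤ B →
    size (chain L π h lo F) + lo * 2 ≤ B * 2 + L * (k * 2 + 4) + size F
  size-chain {zero} {lo = lo} {F} {B} _ _ _ lo≤B = begin
    size F + lo * 2        ≤⟨ +-monoʳ-≤ (size F) (*-monoˡ-≤ 2 lo≤B) ⟩
    size F + B * 2         ≡⟨ +-comm (size F) (B * 2) ⟩
    B * 2 + size F         ≡⟨ cong (_+ size F) (+-identityʳ (B * 2)) ⟨
    B * 2 + 0 + size F     ∎
    where open ≤-Reasoning
  size-chain {suc L} {π} {h} {lo} {F} {B} sorted lo≤h h≤B lo≤B = begin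
    size (chain (suc L) π h lo F) + lo * 2
      ≡⟨ cong₂ (λ a b → suc (a + suc (b + R)) + lo * 2)
               (size-among y x lo (h zero)) (trans (size-∼ _) (size-hasType (π zero) z)) ⟩
    suc ((1 + (h zero ∸ lo) * 2) + suc ((1 + k * 2) + R)) + lo * 2
      ≡⟨ regroup (h zero ∸ lo) lo k R ⟩
    R + (h zero ∸ lo + lo) * 2 + (k * 2 + 4)
      ≡⟨ cong (λ a → R + a * 2 + (k * 2 + 4)) (m∸n+n≡m (lo≤h zero)) ⟩
    R + h zero * 2 + (k * 2 + 4)
      ≤⟨ +-monoˡ-≤ (k * 2 + 4)
           (size-chain (Sorted-suc sorted) (λ s → sorted zero (suc s) z≤n) (h≤B ∘ suc) (h≤B zero)) ⟩
    B * 2 + L * (k * 2 + 4) + size F + (k * 2 + 4)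
      ≡⟨ regroup′ B L (k * 2 + 4) (size F) ⟩
    B * 2 + suc L * (k * 2 + 4) + size F
      ∎
    where
    open ≤-Reasoning
    R = size (chain L (π ∘ suc) (h ∘ suc) (h zero) F)
    regroup : ∀ d lo k R →
      suc ((1 + d * 2) + suc ((1 + k * 2) + R)) + lo * 2 ≡ R + (d + lo) * 2 + (k * 2 + 4)
    regroup = solve-∀
    regroup′ : ∀ B L c s → B * 2 + L * c + s + c ≡ B * 2 + suc L * c + s
    regroup′ = solve-∀

∃ⁿ : ∀ {k m} M → Formula k (M + m) → Formula k m
∃ⁿ zero    φ = φ
∃ⁿ (suc M) φ = ∃ⁿ M (exf φ)

∀ⁿ : ∀ {k m} M → Formula k (M + m) → Formula k m
∀ⁿ zero    φ = φ
∀ⁿ (suc M) φ = ∀ⁿ M (allf φ)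

size-∃ⁿ : ∀ {k m} M (φ : Formula k (M + m)) → size (∃ⁿ M φ) ≡ M + size φ
size-∃ⁿ zero    φ = refl
size-∃ⁿ (suc M) φ = trans (size-∃ⁿ M (exf φ)) (+-suc M (size φ))

size-∀ⁿ : ∀ {k m} M (φ : Formula k (M + m)) → size (∀ⁿ M φ) ≡ M + size φ
size-∀ⁿ zero    φ = refl
size-∀ⁿ (suc M) φ = trans (size-∀ⁿ M (allf φ)) (+-suc M (size φ))

module _ {k n} (N : Model k n) where

  Sat-∃ⁿ⁻ : ∀ {m} M (φ : Formula k (M + m)) {ρ} → Sat N ρ (∃ⁿ M φ) → ∃ λ X → Sat N (X ++ ρ) φ
  Sat-∃ⁿ⁻ zero    φ s = [] , s
  Sat-∃ⁿ⁻ (suc M) φ s with Sat-∃ⁿ⁻ M (exf φ) s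
  ... | X , (a , t) = a ∷ X , t

  Sat-∃ⁿ⁺ : ∀ {m} M (φ : Formula k (M + m)) {ρ} X → Sat N (X ++ ρ) φ → Sat N ρ (∃ⁿ M φ)
  Sat-∃ⁿ⁺ zero    φ []      s = s
  Sat-∃ⁿ⁺ (suc M) φ (a ∷ X) s = Sat-∃ⁿ⁺ M (exf φ) X (a , s)

  Sat-∀ⁿ⁻ : ∀ {m} M (φ : Formula k (M + m)) {ρ} → Sat N ρ (∀ⁿ M φ) → ∀ X → Sat N (X ++ ρ) φ
  Sat-∀ⁿ⁻ zero    φ s []      = s
  Sat-∀ⁿ⁻ (suc M) φ s (a ∷ X) = Sat-∀ⁿ⁻ M (allf φ) s X a

  Sat-∀ⁿ⁺ : ∀ {m} M (φ : Formula k (M + m)) {ρ} → (∀ X → Sat N (X ++ ρ) φ) → Sat N ρ (∀ⁿ M φ)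
  Sat-∀ⁿ⁺ zero    φ s = s []
  Sat-∀ⁿ⁺ (suc M) φ s = Sat-∀ⁿ⁺ M (allf φ) λ X a → s (a ∷ X)

-- Variable xᵢ of the block x₀ … x_{M-1} followed by one more variable; every i ≥ M denotes that
-- last variable, but only indices below M are ever used.
slot : ∀ M → ℕ → Fin (M + 1)
slot zero    i       = zero
slot (suc M) zero    = zero
slot (suc M) (suc i) = suc (slot M i)

lookup-slot-last : ∀ {A : Set} {M} (X : Vec A M) a → lookup (X ++ a ∷ []) (slot M M) ≡ a
lookup-slot-last []      a = refl
lookup-slot-last (_ ∷ X) a = lookup-slot-last X a

lookup-slot-tabulate : ∀ {A : Set} M (f : ℕ → A) a {i} → i < M →
  lookup (tabulate (f ∘ toℕ) ++ a ∷ []) (slot M i) ≡ f i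
lookup-slot-tabulate (suc M) f a {zero}  _   = refl
lookup-slot-tabulate (suc M) f a {suc i} i<M = lookup-slot-tabulate M (f ∘ suc) a (s≤s⁻¹ i<M)

module _ {k L : ℕ} (π : Fin L → TypeT (suc k)) (h : Fin L → ℕ) (M : ℕ) where
  private
    x : ℕ → Fin (suc (M + 1))
    x i = suc (slot M i)
    z : Fin (suc (M + 1))
    z = suc (slot M M)

  -- With z free, y the innermost variable, and π s the type of z:
  --   atMost      ∃x₀ … x_{M-1} ∀y (type y ≠ type z ∨ y ∈ {x₀ , … , x_{h s - 1}})
  --   atLeast π*  ∀x₀ … x_{M-1} ∃y (type y = type z ∧ y ∉ {x₀ , … , x_{h s - 1}}),
  --               where z has type π* if it has none of the types π s.
  atMost : Formula (suc k) 1
  atMost = ∃ⁿ M (allf (∼ sameType zero z ∨f chain zero z x L π h 0 (eq zero zero)))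

  atLeast : TypeT (suc k) → Formula (suc k) 1
  atLeast π* = ∀ⁿ M (exf (sameType zero z ∧f ∼ chain zero z x L π h 0 (∼ hasType π* z)))

  module _ {n} (N : Model (suc k) n) where
    private
      xs : Fin n → Vec (Fin n) M → ℕ → Fin n
      xs z₀ X i = lookup (X ++ z₀ ∷ []) (slot M i)
      last≡ : ∀ z₀ X → xs z₀ X M ≡ z₀
      last≡ z₀ X = lookup-slot-last X z₀

    atMost-sound : Sorted h → (∀ z₀ → Sat N (z₀ ∷ []) atMost) → ∀ s → count N (π s) ≤ h s
    atMost-sound sorted sat s with Fin.any? (λ a → typeOf N a ≟ᵀ π s)
    ... | no  absent = ≤-trans (≤-reflexive (count-absent N λ a a:πs → absent (a , a:πs))) z≤n
    ... | yes (z₀ , z₀:πs) with Sat-∃ⁿ⁻ N M _ (sat z₀)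
    ...   | X , body = ⊆-range⇒cnt≤ (ofType N (π s)) (xs z₀ X) (h s) covered
      where
      Z:πs : typeOf N (xs z₀ X M) ≡ π s
      Z:πs = trans (cong (typeOf N) (last≡ z₀ X)) z₀:πs
      covered : ∀ a → ofType N (π s) a ≡ true → a ∈ xs z₀ X [ 0 , h s ⟩
      covered a a:πs with body a
      ... | inj₁ differ =
        contradiction (Sat-sameType⁺ N zero z (trans (ofType⁻ N a:πs) (sym Z:πs))) (Sat-∼⁻ N _ differ)
      ... | inj₂ sat-chain = chain-sound zero z x N (a ∷ X ++ z₀ ∷ []) sorted (λ _ → z≤n) sat-chain s Z:πs

    atMost-complete : (∀ s → count N (π s) ≤ h s) → (∀ s → h s ≤ M) → ∀ z₀ → Sat N (z₀ ∷ []) atMost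
    atMost-complete count≤h h≤M z₀ = Sat-∃ⁿ⁺ N M _ X body
      where
      e = enumerate z₀ (ofType N (typeOf N z₀))
      X = tabulate (e ∘ toℕ)
      body : ∀ y → Sat N (y ∷ X ++ z₀ ∷ []) (∼ sameType zero z ∨f chain zero z x L π h 0 (eq zero zero))
      body y with typeOf N y ≟ᵀ typeOf N z₀
      ... | no  differ = inj₁ (Sat-∼⁺ N _ λ same →
        differ (trans (Sat-sameType⁻ N zero z same) (cong (typeOf N) (last≡ z₀ X))))
      ... | yes y~z₀ = inj₂ (chain-complete zero z x N _ typed λ _ → refl)
        where
        typed : ∀ s → typeOf N (xs z₀ X M) ≡ π s → y ∈ xs z₀ X [ 0 , h s ⟩
        typed s Z:πs with enumerate-complete z₀ (ofType N (typeOf N z₀)) (ofType⁺ N y~z₀)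
        ... | i , i<count , _ , y≡eᵢ =
          i , i<hs , z≤n , trans y≡eᵢ (sym (lookup-slot-tabulate M e z₀ (≤-trans i<hs (h≤M s))))
          where
          z₀:πs : typeOf N z₀ ≡ π s
          z₀:πs = trans (sym (cong (typeOf N) (last≡ z₀ X))) Z:πs
          i<hs : i < h s
          i<hs = ≤-trans i<count (≤-trans (≤-reflexive (cong (count N) z₀:πs)) (count≤h s))

    atLeast-sound : ∀ {π*} → Injective _≡_ _≡_ π → (∀ s → h s ≤ M) →
      ∀ {z₀} → Sat N (z₀ ∷ []) (atLeast π*) →
      ∀ s → typeOf N z₀ ≡ π s → h s < count N (π s)
    atLeast-sound π-inj h≤M {z₀} sat s z₀:πs = ≰⇒> λ count≤h →
      let (y , same , co) = Sat-∀ⁿ⁻ N M _ sat X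
          y:πs = trans (Sat-sameType⁻ N zero z same) Z:πs
          (i , i<count , _ , y≡eᵢ) = enumerate-complete z₀ (ofType N (π s)) (ofType⁺ N y:πs)
          i<hs = ≤-trans i<count count≤h
      in cochain-sound zero z x N _ π-inj co s Z:πs
           (i , i<hs , z≤n , trans y≡eᵢ (sym (lookup-slot-tabulate M e z₀ (≤-trans i<hs (h≤M s)))))
      where
      e = enumerate z₀ (ofType N (π s))
      X = tabulate (e ∘ toℕ)
      Z:πs : typeOf N (xs z₀ X M) ≡ π s
      Z:πs = trans (cong (typeOf N) (last≡ z₀ X)) z₀:πs

    atLeast-base : ∀ {π* z₀} → Sat N (z₀ ∷ []) (atLeast π*) → (∀ s → typeOf N z₀ ≢ π s) →
      typeOf N z₀ ≡ π*
    atLeast-base {π*} {z₀} sat untyped with Sat-∀ⁿ⁻ N M _ sat X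
      where X = Vec.replicate M z₀
    ... | y , _ , co = trans (cong (typeOf N) (sym (last≡ z₀ X)))
      (Sat-hasType⁻ N π* z (cochain-base zero z x N _ co λ s Z:πs →
        untyped s (trans (cong (typeOf N) (sym (last≡ z₀ X))) Z:πs)))
      where X = Vec.replicate M z₀

    atLeast-complete : ∀ {π*} → Injective _≡_ _≡_ π → Sorted h → (∀ s → h s ≤ M) →
      (∀ s → h s < count N (π s)) → M < count N π* →
      ∀ {z₀} → ((∀ s → typeOf N z₀ ≢ π s) → typeOf N z₀ ≡ π*) → Sat N (z₀ ∷ []) (atLeast π*)
    atLeast-complete {π*} π-inj sorted h≤M h<count M<count {z₀} untyped⇒π* = Sat-∀ⁿ⁺ N M _ body
      where
      body : ∀ X → Sat N (X ++ z₀ ∷ []) (exf (sameType zero z ∧f ∼ chain zero z x L π h 0 (∼ hasType π* z)))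
      body X with Fin.any? (λ s → typeOf N z₀ ≟ᵀ π s)
      ... | yes (s , z₀:πs) with cnt>⇒∉-range (ofType N (π s)) (xs z₀ X) (h s) (h<count s)
      ...   | y , y:πs , y∉ = y , Sat-sameType⁺ N zero z (trans (ofType⁻ N y:πs) (sym Z:πs)) ,
                cochain-complete zero z x N _ sorted (λ _ → z≤n) h≤M typed λ untyped → contradiction Z:πs (untyped s)
        where
        Z:πs : typeOf N (xs z₀ X M) ≡ π s
        Z:πs = trans (cong (typeOf N) (last≡ z₀ X)) z₀:πs
        typed : ∀ t → typeOf N (xs z₀ X M) ≡ π t → ¬ y ∈ xs z₀ X [ 0 , h t ⟩
        typed t Z:πt = subst (λ r → ¬ y ∈ xs z₀ X [ 0 , h r ⟩) (π-inj (trans (sym Z:πs) Z:πt)) y∉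
      body X | no ¬typed with cnt>⇒∉-range (ofType N π*) (xs z₀ X) M M<count
      ...   | y , y:π* , y∉ = y , Sat-sameType⁺ N zero z (trans (ofType⁻ N y:π*) (sym Z:π*)) ,
                cochain-complete zero z x N _ sorted (λ _ → z≤n) h≤M
                  (λ t Z:πt → contradiction (t , trans (cong (typeOf N) (sym (last≡ z₀ X))) Z:πt) ¬typed)
                  (λ _ → Sat-hasType⁺ N π* z Z:π* , y∉)
        where
        Z:π* : typeOf N (xs z₀ X M) ≡ π*
        Z:π* = trans (cong (typeOf N) (last≡ z₀ X)) (untyped⇒π* λ s z₀:πs → ¬typed (s , z₀:πs))

  size-atMost : Sorted h → (∀ s → h s ≤ M) → size atMost ≤ M * 3 + L * (k * 2 + 4) + (k * 8 + 10)
  size-atMost sorted h≤M = begin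
    size atMost                                               ≡⟨ size-∃ⁿ M _ ⟩
    M + suc (suc (size (∼ sameType zero z) + C))
      ≡⟨ cong (λ a → M + suc (suc (a + C))) size-∼sameType ⟩
    M + suc (suc (7 + k * 8 + C))
      ≤⟨ +-monoʳ-≤ M (s≤s (s≤s (+-monoʳ-≤ (7 + k * 8) C≤))) ⟩
    M + suc (suc (7 + k * 8 + (M * 2 + L * (k * 2 + 4) + 1))) ≡⟨ regroup M L k ⟩
    M * 3 + L * (k * 2 + 4) + (k * 8 + 10)                    ∎
    where
    open ≤-Reasoning
    C = size (chain zero z x L π h 0 (eq zero zero))
    C≤ : C ≤ M * 2 + L * (k * 2 + 4) + 1
    C≤ = ≤-trans (m≤m+n C 0) (size-chain zero z x sorted (λ _ → z≤n) h≤M z≤n)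
    size-∼sameType : size (∼ sameType {k} zero z) ≡ 7 + k * 8
    size-∼sameType = trans (size-∼ _) (size-sameType zero z)
    regroup : ∀ M L k → M + suc (suc (7 + k * 8 + (M * 2 + L * (k * 2 + 4) + 1))) ≡ M * 3 + L * (k * 2 + 4) + (k * 8 + 10)
    regroup = solve-∀

  size-atLeast : ∀ π* → Sorted h → (∀ s → h s ≤ M) →
    size (atLeast π*) ≤ M * 3 + L * (k * 2 + 4) + (k * 10 + 10)
  size-atLeast π* sorted h≤M = begin
    size (atLeast π*)                                                   ≡⟨ size-∀ⁿ M _ ⟩
    M + suc (suc (size (sameType {k} zero z) + size (∼ C)))
      ≡⟨ cong₂ (λ a b → M + suc (suc (a + b))) (size-sameType zero z) (size-∼ C) ⟩
    M + suc (suc (7 + k * 8 + size C))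
      ≤⟨ +-monoʳ-≤ M (s≤s (s≤s (+-monoʳ-≤ (7 + k * 8) C≤))) ⟩
    M + suc (suc (7 + k * 8 + (M * 2 + L * (k * 2 + 4) + (1 + k * 2)))) ≡⟨ regroup M L k ⟩
    M * 3 + L * (k * 2 + 4) + (k * 10 + 10)                             ∎
    where
    open ≤-Reasoning
    C = chain zero z x L π h 0 (∼ hasType π* z)
    C≤ : size C ≤ M * 2 + L * (k * 2 + 4) + (1 + k * 2)
    C≤ = ≤-trans (m≤m+n (size C) 0) (subst (λ b → size C + 0 ≤ M * 2 + L * (k * 2 + 4) + b)
      (trans (size-∼ (hasType π* z)) (size-hasType π* z)) (size-chain zero z x sorted (λ _ → z≤n) h≤M z≤n))
    regroup : ∀ M L k → M + suc (suc (7 + k * 8 + (M * 2 + L * (k * 2 + 4) + (1 + k * 2))))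
                        ≡ M * 3 + L * (k * 2 + 4) + (k * 10 + 10)
    regroup = solve-∀

typeCode : ∀ {k} → TypeT k → Fin (2 ^ k)
typeCode π = funToFin (Inverse.from Fin.2↔Bool ∘ lookup π)

typeCode-injective : ∀ {k} → Injective _≡_ _≡_ (typeCode {k})
typeCode-injective {x = π} {π′} same = begin
  π                       ≡⟨ tabulate∘lookup π ⟨
  tabulate (lookup π)     ≡⟨ tabulate-cong lookup≡ ⟩
  tabulate (lookup π′)    ≡⟨ tabulate∘lookup π′ ⟩
  π′                      ∎
  where
  open ≡-Reasoning
  open Inverse Fin.2↔Bool using (to; from; strictlyInverseˡ)
  lookup≡ : ∀ P → lookup π P ≡ lookup π′ P
  lookup≡ P = begin
    lookup π P                                ≡⟨ strictlyInverseˡ (lookup π P) ⟨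
    to (from (lookup π P))                    ≡⟨ cong to (Fin.finToFun-funToFin (from ∘ lookup π) P) ⟨
    to (finToFun (typeCode π) P)              ≡⟨ cong (λ c → to (finToFun c P)) same ⟩
    to (finToFun (typeCode π′) P)             ≡⟨ cong to (Fin.finToFun-funToFin (from ∘ lookup π′) P) ⟩
    to (from (lookup π′ P))                   ≡⟨ strictlyInverseˡ (lookup π′ P) ⟩
    lookup π′ P                               ∎

types≤2^k : ∀ {k ℓ} {π : Fin ℓ → TypeT k} → Injective _≡_ _≡_ π → ℓ ≤ 2 ^ k
types≤2^k π-inj = Fin.injective⇒≤ (π-inj ∘ typeCode-injective)

affine≤cτ : ∀ k ℓ a b → ℓ ≤ 2 ^ suc k → 2 * a + b ≤ 30 * suc k → ℓ * a + b ≤ cτ (suc k)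
affine≤cτ k ℓ a b ℓ≤2p 2a+b≤ = begin
  ℓ * a + b             ≤⟨ +-mono-≤ (*-monoˡ-≤ a ℓ≤2p) (m≤n*m b p) ⟩
  2 * p * a + p * b     ≡⟨ regroup p a b ⟩
  p * (2 * a + b)       ≤⟨ *-monoʳ-≤ p 2a+b≤ ⟩
  p * (30 * suc k)      ≡⟨ regroup′ p k ⟩
  15 * suc k * (2 * p)  ∎
  where
  open ≤-Reasoning
  p = 2 ^ k
  instance _ = >-nonZero (m^n>0 2 k)
  regroup : ∀ p a b → 2 * p * a + p * b ≡ p * (2 * a + b)
  regroup = solve-∀
  regroup′ : ∀ p k → p * (30 * suc k) ≡ 15 * suc k * (2 * p)
  regroup′ = solve-∀

fromℕ-or-inject₁ : ∀ {n} (j : Fin (suc n)) → j ≡ fromℕ n ⊎ ∃ λ i → inject₁ i ≡ j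
fromℕ-or-inject₁ {n} j with j Fin.≟ fromℕ n
... | yes j≡n = inj₁ j≡n
... | no  j≢n = inj₂ (Fin.lower₁ j n≢j , Fin.inject₁-lower₁ j n≢j)
  where
  n≢j : n ≢ toℕ j
  n≢j n≡j = j≢n (Fin.toℕ-injective (trans (sym n≡j) (sym (Fin.toℕ-fromℕ n))))

record SortedTypes {k n} (M : Model k n) (ℓ : ℕ) (π : Fin ℓ → TypeT k) : Set where
  field
    injective : Injective _≡_ _≡_ π
    realized  : ∀ j → ∃ λ a → Realizes M a (π j)
    covers    : Covers M π
    sorted    : Sorted (count M ∘ π)

  count>0 : ∀ j → 0 < count M (π j)
  count>0 j = let (a , a:πj) = realized j in cnt>0 (ofType M (π j)) (ofType⁺ M a:πj)

module _ {k n L} {M : Model (suc k) n} {π : Fin (suc L) → TypeT (suc k)} (T : SortedTypes M (suc L) π) where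
  open SortedTypes T
  private
    h = count M ∘ π
    Mx = h (fromℕ L)

  upperBoundSentence : Sentence (suc k)
  upperBoundSentence = allf (⋁ L (λ j → hasType (π j) zero) ∧f atMost π h Mx)

  upperBoundSentence-holds : M ⊨ upperBoundSentence
  upperBoundSentence-holds z₀ = let (j , z₀:πj) = covers z₀ in
    Sat-⋁⁺ M L _ j (Sat-hasType⁺ M (π j) zero z₀:πj) ,
    atMost-complete π h Mx M (λ _ → ≤-refl) (Sorted-≤last sorted) z₀

  upperBoundSentence-categorical : ∀ M′ → M′ ⊨ upperBoundSentence → M′ ≅ M
  upperBoundSentence-categorical M′ sat =
    ≅-from-type-counts M M′ covers covers′ (≤∧∑≡⇒≡ count′≤count same-total)
    where
    covers′ : Covers M′ π
    covers′ a = let (j , a:πj) = Sat-⋁⁻ M′ L _ (proj₁ (sat a)) in j , Sat-hasType⁻ M′ (π j) zero a:πj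
    count′≤count : ∀ j → count M′ (π j) ≤ count M (π j)
    count′≤count = atMost-sound π h Mx M′ sorted (proj₂ ∘ sat)
    same-total : ∑[ j < suc L ] count M′ (π j) ≡ ∑[ j < suc L ] count M (π j)
    same-total = trans (count-total M′ injective covers′) (sym (count-total M injective covers))

  size-upperBoundSentence : size upperBoundSentence ≤ 3 * Mx + cτ (suc k)
  size-upperBoundSentence = begin
    size upperBoundSentence
      ≡⟨ cong (λ a → suc (suc (a + size (atMost π h Mx)))) (size-⋁ L _ λ j → size-hasType (π j) zero) ⟩
    suc (suc (1 + k * 2 + L * suc (1 + k * 2) + size (atMost π h Mx)))
      ≤⟨ s≤s (s≤s (+-monoʳ-≤ (1 + k * 2 + L * suc (1 + k * 2))
                              (size-atMost π h Mx sorted (Sorted-≤last sorted)))) ⟩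
    suc (suc (1 + k * 2 + L * suc (1 + k * 2) + (Mx * 3 + suc L * (k * 2 + 4) + (k * 8 + 10))))
      ≡⟨ regroup Mx L k ⟩
    3 * Mx + (suc L * (k * 4 + 6) + (k * 8 + 11))
      ≤⟨ +-monoʳ-≤ (3 * Mx) (affine≤cτ k (suc L) (k * 4 + 6) (k * 8 + 11) (types≤2^k injective) (slack k)) ⟩
    3 * Mx + cτ (suc k)
      ∎
    where
    open ≤-Reasoning
    regroup : ∀ Mx L k → suc (suc (1 + k * 2 + L * suc (1 + k * 2) + (Mx * 3 + suc L * (k * 2 + 4) + (k * 8 + 10))))
                         ≡ 3 * Mx + (suc L * (k * 4 + 6) + (k * 8 + 11))
    regroup = solve-∀
    slack : ∀ k → 2 * (k * 4 + 6) + (k * 8 + 11) ≤ 30 * suc k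
    slack k = subst₂ _≤_ (regroup′ k) (regroup″ k) (m≤m+n (k * 16 + 23) (k * 14 + 7))
      where
      regroup′ : ∀ k → k * 16 + 23 ≡ 2 * (k * 4 + 6) + (k * 8 + 11)
      regroup′ = solve-∀
      regroup″ : ∀ k → k * 16 + 23 + (k * 14 + 7) ≡ 30 * suc k
      regroup″ = solve-∀

  upperBoundSentence-definable : DefinableWithin M (3 * Mx + cτ (suc k))
  upperBoundSentence-definable =
    upperBoundSentence ,
    defines {φ = upperBoundSentence} upperBoundSentence-holds upperBoundSentence-categorical ,
    size-upperBoundSentence

module _ {k n L} {M : Model (suc k) n} {π : Fin (suc (suc L)) → TypeT (suc k)} (T : SortedTypes M (suc (suc L)) π) where
  open SortedTypes T
  private
    π⁻ = π ∘ inject₁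
    π* = π (fromℕ (suc L))
    h = count M ∘ π⁻
    Mx = h (fromℕ L)
    sorted⁻ : Sorted h
    sorted⁻ = Sorted-inject₁ sorted
    injective⁻ : Injective _≡_ _≡_ π⁻
    injective⁻ = Fin.inject₁-injective ∘ injective
    h≤Mx : ∀ s → h s ≤ Mx
    h≤Mx = Sorted-≤last sorted⁻
    pred-h≤ : ∀ s → pred (h s) ≤ pred Mx
    pred-h≤ = pred-mono-≤ ∘ h≤Mx

  -- atLeast bounds counts strictly from below, hence the predecessors.
  exactCountSentence : Sentence (suc k)
  exactCountSentence =
    allf (atMost π⁻ h Mx ∧f atLeast π⁻ (pred ∘ h) (pred Mx) π*) ∧f ⋀ L (λ s → exf (hasType (π⁻ s) zero))

  exactCountSentence-holds : M ⊨ exactCountSentence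
  exactCountSentence-holds =
    (λ z₀ → atMost-complete π⁻ h Mx M (λ _ → ≤-refl) h≤Mx z₀ ,
            atLeast-complete π⁻ (pred ∘ h) (pred Mx) M injective⁻ (Sorted-pred sorted⁻) pred-h≤
              (λ s → pred< (count>0 (inject₁ s)))
              (≤-trans (pred< (count>0 (inject₁ (fromℕ L)))) (Sorted-≤last sorted (inject₁ (fromℕ L))))
              (untyped⇒π* z₀)) ,
    Sat-⋀⁺ M L _ λ s → let (a , a:π⁻s) = realized (inject₁ s) in a , Sat-hasType⁺ M (π⁻ s) zero a:π⁻s
    where
    pred< : ∀ {x} → 0 < x → pred x < x
    pred< (s≤s _) = ≤-refl
    untyped⇒π* : ∀ z₀ → (∀ s → typeOf M z₀ ≢ π⁻ s) → typeOf M z₀ ≡ π*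
    untyped⇒π* z₀ untyped with covers z₀
    ... | j , z₀:πj with fromℕ-or-inject₁ j
    ...   | inj₁ refl       = z₀:πj
    ...   | inj₂ (s , refl) = contradiction z₀:πj (untyped s)

  exactCountSentence-categorical : ∀ M′ → M′ ⊨ exactCountSentence → M′ ≅ M
  exactCountSentence-categorical M′ (sat , sat-realized) = ≅-from-type-counts M M′ covers covers′ count′≡count
    where
    covers′ : Covers M′ π
    covers′ a with Fin.any? (λ s → typeOf M′ a ≟ᵀ π⁻ s)
    ... | yes (s , a:π⁻s) = inject₁ s , a:π⁻s
    ... | no  untyped     =
      fromℕ (suc L) , atLeast-base π⁻ (pred ∘ h) (pred Mx) M′ (proj₂ (sat a)) λ s e → untyped (s , e)
    pred<⇒≤ : ∀ {x y} → pred x < y → x ≤ y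
    pred<⇒≤ {zero}  _ = z≤n
    pred<⇒≤ {suc x} p = p
    count′≡count⁻ : ∀ s → count M′ (π⁻ s) ≡ h s
    count′≡count⁻ s with Sat-⋀⁻ M′ L _ sat-realized s
    ... | a , a:π⁻s = ≤-antisym (atMost-sound π⁻ h Mx M′ sorted⁻ (proj₁ ∘ sat) s)
      (pred<⇒≤ (atLeast-sound π⁻ (pred ∘ h) (pred Mx) M′ {π*} injective⁻ pred-h≤ (proj₂ (sat a)) s
                                (Sat-hasType⁻ M′ (π⁻ s) zero a:π⁻s)))
    off-last : ∀ j → j ≢ fromℕ (suc L) → count M′ (π j) ≡ count M (π j)
    off-last j j≢last with fromℕ-or-inject₁ j
    ... | inj₁ j≡last     = contradiction j≡last j≢last
    ... | inj₂ (s , refl) = count′≡count⁻ s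
    same-total : ∑[ j < suc (suc L) ] count M′ (π j) ≡ ∑[ j < suc (suc L) ] count M (π j)
    same-total = trans (count-total M′ injective covers′) (sym (count-total M injective covers))
    count′≡count : ∀ j → count M′ (π j) ≡ count M (π j)
    count′≡count j with j Fin.≟ fromℕ (suc L)
    ... | yes refl    = ∑-cancel j same-total off-last
    ... | no  j≢last  = off-last j j≢last

  size-exactCountSentence : size exactCountSentence ≤ 6 * Mx + cτ (suc k)
  size-exactCountSentence = begin
    size exactCountSentence
      ≡⟨ cong (λ r → suc (suc (suc (size A + size B)) + r))
              (size-⋀ L _ λ s → cong suc (size-hasType (π⁻ s) zero)) ⟩
    suc (suc (suc (size A + size B)) + R)
      ≤⟨ s≤s (+-monoˡ-≤ R (s≤s (s≤s (+-mono-≤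
           (size-atMost π⁻ h Mx sorted⁻ h≤Mx)
           (size-atLeast π⁻ (pred ∘ h) (pred Mx) π* (Sorted-pred sorted⁻) pred-h≤))))) ⟩
    suc (suc (suc (Mx * 3 + c + c₁ + (pred Mx * 3 + c + c₂))) + R)
      ≡⟨ cong (λ t → suc (suc (suc (t * 3 + c + c₁ + (pred Mx * 3 + c + c₂))) + R)) Mx≡ ⟩
    suc (suc (suc (suc (pred Mx) * 3 + c + c₁ + (pred Mx * 3 + c + c₂))) + R)
      ≡⟨ regroup (pred Mx) L k ⟩
    6 * suc (pred Mx) + (suc (suc L) * (k * 6 + 11) + (k * 12 + 8))
      ≡⟨ cong (λ t → 6 * t + (suc (suc L) * (k * 6 + 11) + (k * 12 + 8))) Mx≡ ⟨
    6 * Mx + (suc (suc L) * (k * 6 + 11) + (k * 12 + 8))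
      ≤⟨ +-monoʳ-≤ (6 * Mx)
           (affine≤cτ k (suc (suc L)) (k * 6 + 11) (k * 12 + 8) (types≤2^k injective) (slack k)) ⟩
    6 * Mx + cτ (suc k)
      ∎
    where
    open ≤-Reasoning
    A = atMost π⁻ h Mx
    B = atLeast π⁻ (pred ∘ h) (pred Mx) π*
    R = suc (1 + k * 2) + L * suc (suc (1 + k * 2))
    c = suc L * (k * 2 + 4)
    c₁ = k * 8 + 10
    c₂ = k * 10 + 10
    Mx≡ : Mx ≡ suc (pred Mx)
    Mx≡ = sym (suc-pred Mx {{>-nonZero (count>0 (inject₁ (fromℕ L)))}})
    regroup : ∀ m L k →
      suc (suc (suc (suc m * 3 + suc L * (k * 2 + 4) + (k * 8 + 10) + (m * 3 + suc L * (k * 2 + 4) + (k * 10 + 10))))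
        + (suc (1 + k * 2) + L * suc (suc (1 + k * 2))))
      ≡ 6 * suc m + (suc (suc L) * (k * 6 + 11) + (k * 12 + 8))
    regroup = solve-∀
    slack : ∀ k → 2 * (k * 6 + 11) + (k * 12 + 8) ≤ 30 * suc k
    slack k = subst₂ _≤_ (regroup′ k) (regroup″ k) (m≤m+n (k * 24 + 30) (k * 6))
      where
      regroup′ : ∀ k → k * 24 + 30 ≡ 2 * (k * 6 + 11) + (k * 12 + 8)
      regroup′ = solve-∀
      regroup″ : ∀ k → k * 24 + 30 + k * 6 ≡ 30 * suc k
      regroup″ = solve-∀

  exactCountSentence-definable : DefinableWithin M (6 * Mx + cτ (suc k))
  exactCountSentence-definable =
    exactCountSentence ,
    defines {φ = exactCountSentence} exactCountSentence-holds exactCountSentence-categorical ,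
    size-exactCountSentence

≅-in-empty-vocabulary : ∀ {n} (M M′ : Model 0 n) → M′ ≅ M
≅-in-empty-vocabulary M M′ = ↔⇒⤖ Perm.id , λ ()

empty-vocabulary-definable : ∀ {n} (M : Model 0 n) → DefinableWithin M 2
empty-vocabulary-definable M =
  allf (eq zero zero) ,
  defines {M = M} {allf (eq zero zero)} (λ _ → refl) (λ M′ _ → ≅-in-empty-vocabulary M M′) ,
  ≤-refl

theorem1 : (k n : ℕ) → 1 ≤ n → (M : Model k n) →
    (ℓ : ℕ) → (π : Fin ℓ → TypeT k) →
    Injective _≡_ _≡_ π →
    ((j : Fin ℓ) → Σ (Fin n) λ a → Realizes M a (π j)) →
    ((a : Fin n) → Σ (Fin ℓ) λ j → Realizes M a (π j)) →
    ((i j : Fin ℓ) → i ≤F j → count M (π i) ≤ count M (π j)) →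
    Σ (Sentence k) λ φ →
      Defines φ M × size φ ≤ bound (cτ k) ℓ (λ j → count M (π j))
theorem1 k n 1≤n M ℓ π injective realized covers sorted =
  definable k ℓ {M}
    (record { injective = injective ; realized = realized ; covers = covers ; sorted = sorted })
    (proj₁ (covers (Fin.fromℕ< 1≤n)))
  where
  definable : ∀ k ℓ {M : Model k n} {π : Fin ℓ → TypeT k} → SortedTypes M ℓ π → Fin ℓ →
    DefinableWithin M (bound (cτ k) ℓ (count M ∘ π))
  definable _    zero          T ()
  definable zero (suc zero) {M} {π} T _ =
    DefinableWithin-mono {M = M} 2≤bound (empty-vocabulary-definable M)
    where
    2≤bound : 2 ≤ 3 * count M (π zero) + 0
    2≤bound = ≤-trans (n≤1+n 2) (≤-trans (*-monoʳ-≤ 3 (SortedTypes.count>0 T zero)) (m≤m+n _ 0))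
  definable zero (suc (suc ℓ)) T _ = contradiction (types≤2^k (SortedTypes.injective T)) λ { (s≤s ()) }
  definable (suc k) (suc zero)     T _ = upperBoundSentence-definable T
  definable (suc k) (suc (suc L)) {M} T _ =
    DefinableWithin-⊓ {M = M} (upperBoundSentence-definable T) (exactCountSentence-definable T)
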